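{- Let $p\ge 5$ be a prime, $a,b,c,r,s,t\in \mathbb{N}$ and $n,m\in \mathbb{Z}^{+}$. Then \begin{align*} &{np^m-1\choose a}^r {np^m+b\choose b}^s {c\choose np^m}^t\\ &\equiv (-1)^{r(a+\lfloor a/p\rfloor)}{np^{m-1}-1\choose \lfloor a/p\rfloor}^r {np^{m-1}+\lfloor b/p\rfloor\choose \lfloor b/p\rfloor}^s {\lfloor c/p\rfloor \choose np^{m-1}}^t\\ &\times\left(1-rnp^m\sum_{\substack{1\le j\le a\\ p\nmid j}}\frac{1}{j} +snp^m\sum_{\substack{1\le j\le b\\ p\nmid j}}\frac{1}{j}+tnp^m\sum_{\substack{1\le j\le c\\ p\nmid j}}\frac{1}{j}\right)\pmod{p^{m+1}}. \end{align*}
   Context: $\mathbb{N}$ denotes the non-negative integers, $\mathbb{Z}^{+}$ the positive integers, and $\lfloor x\rfloor$ the integral part of $x$. Each sum runs only over indices $j$ not divisible by $p$. -}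

module Defs where

open import Data.Nat as ℕ using (ℕ; zero; suc)
open import Data.Nat.Divisibility using (_∣_; _∣?_)
open import Data.Integer as ℤ using (ℤ; +_)
open import Data.Rational using (ℚ; _/_; _+_; _-_; _*_; 0ℚ; 1ℚ)
open import Data.Product using (∃-syntax; _×_)
open import Relation.Nullary using (¬_; yes; no)
open import Relation.Binary.PropositionalEquality using (_≡_)

ℕ→ℚ : ℕ → ℚ
ℕ→ℚ k = + k / 1

ℤ→ℚ : ℤ → ℚ
ℤ→ℚ z = z / 1

_^ᵠ_ : ℚ → ℕ → ℚ
x ^ᵠ zero  = 1ℚ
x ^ᵠ suc e = x * (x ^ᵠ e)

H : ℕ → ℕ → ℚ
H p zero = 0ℚ
H p (suc j) with p ∣? suc j
... | yes _ = H p j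
... | no  _ = H p j + (+ 1 / suc j)

-- x ≡ y (mod q) for rationals: (x - y) = q * (u / v) with u ∈ ℤ, v ∈ ℕ, p ∤ v
-- (i.e. (x - y)/q is p-integral); here q = p ^ k.
ModEq : ℕ → ℕ → ℚ → ℚ → Set
ModEq p k x y = ∃[ u ] ∃[ v ] (¬ p ∣ v) × ((x - y) * ℕ→ℚ v ≡ ℕ→ℚ (p ℕ.^ k) * ℤ→ℚ u)

{-# OPTIONS --safe #-}
module Submission where

-- Put N = n p^m = p M. Sorting the factors of the binomial coefficients by divisibility by p
-- gives exact identities
--   C(N-1,a) = (-1)^(a+⌊a/p⌋) C(M-1,⌊a/p⌋) ∏_{j≤a, p∤j} (1 - N/j),
--   C(N+b,b) = C(M+⌊b/p⌋,⌊b/p⌋) ∏_{j≤b, p∤j} (1 + N/j),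
-- and C(N+b,N) = C(⌊(N+b)/p⌋,M) ∏_{j≤b, p∤j} (1 + N/j), while C(c,N) = C(⌊c/p⌋,M) = 0 for c < N.
-- Since p^m ∣ N, each product is 1 ± N H modulo p^(2m), so modulo p^(m+1); and numbers of the
-- form 1 + N h with h p-integral are closed, modulo p^(m+1), under products and powers, the h's
-- adding up. For C(N+b,N) one still needs H(N+b) ≡ H(b) (mod p), which follows from
-- H(j+p) ≡ H(j) + H(p) and H(p) ≡ 0 (mod p), the latter by pairing 1/j with 1/(p-j) (p odd).

open import Data.Product using (∃-syntax; _×_; _,_; proj₁; proj₂)
open import Data.Sum using (inj₁; inj₂; [_,_]′)
open import Relation.Nullary using (¬_; yes; no; contradiction)
open import Relation.Nullary.Decidable using (toSum)
open import Relation.Binary.PropositionalEquality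

open import Data.Nat as ℕ using (ℕ; zero; suc; _≤_; _<_; NonZero; z≤n; s≤s)
import Data.Nat.Properties as ℕ
import Data.Nat.Tactic.RingSolver as ℕ-Solver
open import Data.Nat.DivMod using (m≡m%n+[m/n]*n; m%n<n; %-pred-≡0; m<n⇒m/n≡0; m*n/n≡m;
  0/n≡0; +-distrib-/-∣ˡ; +-distrib-/-∣ʳ; m<n*o⇒m/o<n)
open import Data.Nat.Divisibility using (_∣_; _∣?_; divides; ∣-refl; ∣-reflexive; ∣1⇒≡1; >⇒∤;
  n∣m*n; m∣m*n; ∣m∣n⇒∣m+n; ∣m+n∣m⇒∣n; n∣m⇒m%n≡0)
open import Data.Nat.Primality using (Prime; euclidsLemma; ¬prime[1]; prime⇒nonZero)
open import Data.Nat.Combinatorics using (_C_; nCk+nC[k+1]≡[n+1]C[k+1]; k>n⇒nCk≡0; nCk≡nC[n∸k]; nC1≡n)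
open import Data.Integer as ℤ using (ℤ; +_)
import Data.Integer.Properties as ℤ
import Data.Integer.Tactic.RingSolver as ℤ-Solver
open import Data.Rational using (ℚ; _+_; _-_; _*_; -_; 0ℚ; 1ℚ; _/_; fromℚᵘ)
import Data.Rational.Properties as ℚ
import Data.Rational.Unnormalised as ℚᵘ
import Data.Rational.Unnormalised.Properties as ℚᵘ
open import Data.Rational.Solver using (module +-*-Solver)
open +-*-Solver using (solve; _:=_; con; _:+_; _:*_; :-_; _:-_)

open import Defs

open ≡-Reasoning

-- ℤ→ℚ z and + 1 / suc n are definitionally fromℚᵘ (mkℚᵘ z 0) and fromℚᵘ (mkℚᵘ (+ 1) n), so the
-- casts inherit the homomorphism properties of fromℚᵘ.
fromℚᵘ-homo-+ : ∀ x y → fromℚᵘ (x ℚᵘ.+ y) ≡ fromℚᵘ x + fromℚᵘ y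
fromℚᵘ-homo-+ x y = ℚ.toℚᵘ-injective (ℚᵘ.≃-trans (ℚ.toℚᵘ-fromℚᵘ (x ℚᵘ.+ y)) (ℚᵘ.≃-sym
  (ℚᵘ.≃-trans (ℚ.toℚᵘ-homo-+ (fromℚᵘ x) (fromℚᵘ y))
              (ℚᵘ.+-cong (ℚ.toℚᵘ-fromℚᵘ x) (ℚ.toℚᵘ-fromℚᵘ y)))))

fromℚᵘ-homo-* : ∀ x y → fromℚᵘ (x ℚᵘ.* y) ≡ fromℚᵘ x * fromℚᵘ y
fromℚᵘ-homo-* x y = ℚ.toℚᵘ-injective (ℚᵘ.≃-trans (ℚ.toℚᵘ-fromℚᵘ (x ℚᵘ.* y)) (ℚᵘ.≃-sym
  (ℚᵘ.≃-trans (ℚ.toℚᵘ-homo-* (fromℚᵘ x) (fromℚᵘ y))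
              (ℚᵘ.*-cong (ℚ.toℚᵘ-fromℚᵘ x) (ℚ.toℚᵘ-fromℚᵘ y)))))

fromℚᵘ-homo‿- : ∀ x → fromℚᵘ (ℚᵘ.- x) ≡ - fromℚᵘ x
fromℚᵘ-homo‿- x = ℚ.toℚᵘ-injective (ℚᵘ.≃-trans (ℚ.toℚᵘ-fromℚᵘ (ℚᵘ.- x)) (ℚᵘ.≃-sym
  (ℚᵘ.≃-trans (ℚ.toℚᵘ-homo‿- (fromℚᵘ x)) (ℚᵘ.-‿cong (ℚ.toℚᵘ-fromℚᵘ x)))))

ℤ→ℚ-+ : ∀ i j → ℤ→ℚ (i ℤ.+ j) ≡ ℤ→ℚ i + ℤ→ℚ j
ℤ→ℚ-+ i j =
  trans (ℚ.fromℚᵘ-cong {ℚᵘ.mkℚᵘ (i ℤ.+ j) 0} {ℚᵘ.mkℚᵘ i 0 ℚᵘ.+ ℚᵘ.mkℚᵘ j 0} (ℚᵘ.*≡* (eq i j)))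
        (fromℚᵘ-homo-+ (ℚᵘ.mkℚᵘ i 0) (ℚᵘ.mkℚᵘ j 0))
  where
  eq : ∀ i j → (i ℤ.+ j) ℤ.* ℤ.1ℤ ≡ (i ℤ.* ℤ.1ℤ ℤ.+ j ℤ.* ℤ.1ℤ) ℤ.* ℤ.1ℤ
  eq = ℤ-Solver.solve-∀

ℤ→ℚ-* : ∀ i j → ℤ→ℚ (i ℤ.* j) ≡ ℤ→ℚ i * ℤ→ℚ j
ℤ→ℚ-* i j = fromℚᵘ-homo-* (ℚᵘ.mkℚᵘ i 0) (ℚᵘ.mkℚᵘ j 0)

ℤ→ℚ-neg : ∀ i → ℤ→ℚ (ℤ.- i) ≡ - ℤ→ℚ i
ℤ→ℚ-neg i = fromℚᵘ-homo‿- (ℚᵘ.mkℚᵘ i 0)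

ℕ→ℚ-+ : ∀ m n → ℕ→ℚ (m ℕ.+ n) ≡ ℕ→ℚ m + ℕ→ℚ n
ℕ→ℚ-+ m n = trans (cong ℤ→ℚ (ℤ.pos-+ m n)) (ℤ→ℚ-+ (+ m) (+ n))

ℕ→ℚ-* : ∀ m n → ℕ→ℚ (m ℕ.* n) ≡ ℕ→ℚ m * ℕ→ℚ n
ℕ→ℚ-* m n = trans (cong ℤ→ℚ (ℤ.pos-* m n)) (ℤ→ℚ-* (+ m) (+ n))

1/n*n≡1 : ∀ n .{{_ : NonZero n}} → + 1 / n * ℕ→ℚ n ≡ 1ℚ
1/n*n≡1 (suc n) = trans (sym (fromℚᵘ-homo-* (ℚᵘ.mkℚᵘ (+ 1) n) (ℚᵘ.mkℚᵘ (+ suc n) 0)))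
  (ℚ.fromℚᵘ-cong {ℚᵘ.mkℚᵘ (+ 1) n ℚᵘ.* ℚᵘ.mkℚᵘ (+ suc n) 0} {ℚᵘ.1ℚᵘ} (ℚᵘ.*≡* eq))
  where
  unit : ∀ x → + 1 ℤ.* x ℤ.* ℤ.1ℤ ≡ ℤ.1ℤ ℤ.* x
  unit = ℤ-Solver.solve-∀
  eq : + 1 ℤ.* + suc n ℤ.* ℤ.1ℤ ≡ ℤ.1ℤ ℤ.* + suc (n ℕ.* 1)
  eq = trans (unit (+ suc n)) (cong (λ k → ℤ.1ℤ ℤ.* + suc k) (sym (ℕ.*-identityʳ n)))

ℕ→ℚ-*-cancelˡ : ∀ n .{{_ : NonZero n}} {x y} → ℕ→ℚ n * x ≡ ℕ→ℚ n * y → x ≡ y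
ℕ→ℚ-*-cancelˡ n {x} {y} nx≡ny = trans (sym (1/n*[n*z]≡z x)) (trans (cong (+ 1 / n *_) nx≡ny) (1/n*[n*z]≡z y))
  where
  1/n*[n*z]≡z : ∀ z → + 1 / n * (ℕ→ℚ n * z) ≡ z
  1/n*[n*z]≡z z = trans (sym (ℚ.*-assoc (+ 1 / n) (ℕ→ℚ n) z)) (trans (cong (_* z) (1/n*n≡1 n)) (ℚ.*-identityˡ z))

^ᵠ-distribʳ-* : ∀ x y r → (x * y) ^ᵠ r ≡ x ^ᵠ r * y ^ᵠ r
^ᵠ-distribʳ-* x y zero    = refl
^ᵠ-distribʳ-* x y (suc r) = trans (cong ((x * y) *_) (^ᵠ-distribʳ-* x y r)) (interchange x y (x ^ᵠ r) (y ^ᵠ r))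
  where
  interchange : ∀ a b c d → (a * b) * (c * d) ≡ (a * c) * (b * d)
  interchange = solve 4 (λ a b c d → (a :* b) :* (c :* d) := (a :* c) :* (b :* d)) refl

^ᵠ-distribˡ-+-* : ∀ x m n → x ^ᵠ (m ℕ.+ n) ≡ x ^ᵠ m * x ^ᵠ n
^ᵠ-distribˡ-+-* x zero    n = sym (ℚ.*-identityˡ (x ^ᵠ n))
^ᵠ-distribˡ-+-* x (suc m) n = trans (cong (x *_) (^ᵠ-distribˡ-+-* x m n)) (sym (ℚ.*-assoc x (x ^ᵠ m) (x ^ᵠ n)))

x^[m*n]≡[x^n]^m : ∀ x m n → x ^ᵠ (m ℕ.* n) ≡ (x ^ᵠ n) ^ᵠ m
x^[m*n]≡[x^n]^m x zero    n = refl
x^[m*n]≡[x^n]^m x (suc m) n = trans (^ᵠ-distribˡ-+-* x n (m ℕ.* n)) (cong (x ^ᵠ n *_) (x^[m*n]≡[x^n]^m x m n))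

[1+k]*[1+n]C[1+k]≡[1+n]*nCk : ∀ n k → suc k ℕ.* (suc n C suc k) ≡ suc n ℕ.* (n C k)
[1+k]*[1+n]C[1+k]≡[1+n]*nCk zero    zero    = refl
[1+k]*[1+n]C[1+k]≡[1+n]*nCk zero    (suc k) =
  trans (cong (suc (suc k) ℕ.*_) (k>n⇒nCk≡0 {1} {suc (suc k)} (s≤s (s≤s z≤n)))) (ℕ.*-zeroʳ (suc (suc k)))
[1+k]*[1+n]C[1+k]≡[1+n]*nCk (suc n) zero    =
  trans (ℕ.*-identityˡ _) (trans (nC1≡n (suc (suc n))) (sym (ℕ.*-identityʳ (suc (suc n)))))
[1+k]*[1+n]C[1+k]≡[1+n]*nCk (suc n) (suc k) = begin
  suc (suc k) ℕ.* (suc (suc n) C suc (suc k))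
    ≡⟨ cong (suc (suc k) ℕ.*_) (nCk+nC[k+1]≡[n+1]C[k+1] (suc n) (suc k)) ⟨
  suc (suc k) ℕ.* (suc n C suc k ℕ.+ suc n C suc (suc k))
    ≡⟨ split k (suc n C suc k) (suc n C suc (suc k)) ⟩
  suc n C suc k ℕ.+ (suc k ℕ.* (suc n C suc k) ℕ.+ suc (suc k) ℕ.* (suc n C suc (suc k)))
    ≡⟨ cong (suc n C suc k ℕ.+_) (cong₂ ℕ._+_ ([1+k]*[1+n]C[1+k]≡[1+n]*nCk n k)
                                               ([1+k]*[1+n]C[1+k]≡[1+n]*nCk n (suc k))) ⟩
  suc n C suc k ℕ.+ (suc n ℕ.* (n C k) ℕ.+ suc n ℕ.* (n C suc k))
    ≡⟨ cong (suc n C suc k ℕ.+_) (trans (sym (ℕ.*-distribˡ-+ (suc n) (n C k) (n C suc k)))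
                                         (cong (suc n ℕ.*_) (nCk+nC[k+1]≡[n+1]C[k+1] n k))) ⟩
  suc n C suc k ℕ.+ suc n ℕ.* (suc n C suc k)
    ∎
  where
  split : ∀ k a b → suc (suc k) ℕ.* (a ℕ.+ b) ≡ a ℕ.+ (suc k ℕ.* a ℕ.+ suc (suc k) ℕ.* b)
  split = ℕ-Solver.solve-∀

[1+k]*nC[1+k]≡[n-k]*nCk : ∀ n k →
  ℕ→ℚ (suc k) * ℕ→ℚ (n C suc k) ≡ (ℕ→ℚ (suc n) - ℕ→ℚ (suc k)) * ℕ→ℚ (n C k)
[1+k]*nC[1+k]≡[n-k]*nCk n k = begin
  X                                   ≡⟨ add-sub X Y ⟨
  X + Y - Y                           ≡⟨ cong (_- Y) X+Y≡[1+n]*nCk ⟩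
  ℕ→ℚ (suc n) * ℕ→ℚ (n C k) - Y       ≡⟨ *-distribʳ-- (ℕ→ℚ (suc n)) (ℕ→ℚ (suc k)) (ℕ→ℚ (n C k)) ⟩
  (ℕ→ℚ (suc n) - ℕ→ℚ (suc k)) * ℕ→ℚ (n C k) ∎
  where
  X = ℕ→ℚ (suc k) * ℕ→ℚ (n C suc k)
  Y = ℕ→ℚ (suc k) * ℕ→ℚ (n C k)
  add-sub : ∀ x y → x + y - y ≡ x
  add-sub = solve 2 (λ x y → x :+ y :- y := x) refl
  *-distribʳ-- : ∀ a b c → a * c - b * c ≡ (a - b) * c
  *-distribʳ-- = solve 3 (λ a b c → a :* c :- b :* c := (a :- b) :* c) refl
  X+Y≡[1+n]*nCk : X + Y ≡ ℕ→ℚ (suc n) * ℕ→ℚ (n C k)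
  X+Y≡[1+n]*nCk = begin
    X + Y
      ≡⟨ cong₂ _+_ (ℕ→ℚ-* (suc k) (n C suc k)) (ℕ→ℚ-* (suc k) (n C k)) ⟨
    ℕ→ℚ (suc k ℕ.* (n C suc k)) + ℕ→ℚ (suc k ℕ.* (n C k))
      ≡⟨ ℕ→ℚ-+ (suc k ℕ.* (n C suc k)) (suc k ℕ.* (n C k)) ⟨
    ℕ→ℚ (suc k ℕ.* (n C suc k) ℕ.+ suc k ℕ.* (n C k))
      ≡⟨ cong ℕ→ℚ pascal ⟩
    ℕ→ℚ (suc n ℕ.* (n C k))
      ≡⟨ ℕ→ℚ-* (suc n) (n C k) ⟩
    ℕ→ℚ (suc n) * ℕ→ℚ (n C k)
      ∎
    where
    pascal : suc k ℕ.* (n C suc k) ℕ.+ suc k ℕ.* (n C k) ≡ suc n ℕ.* (n C k)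
    pascal = begin
      suc k ℕ.* (n C suc k) ℕ.+ suc k ℕ.* (n C k) ≡⟨ ℕ.*-distribˡ-+ (suc k) (n C suc k) (n C k) ⟨
      suc k ℕ.* (n C suc k ℕ.+ n C k)             ≡⟨ cong (suc k ℕ.*_) (trans (ℕ.+-comm (n C suc k) (n C k))
                                                                         (nCk+nC[k+1]≡[n+1]C[k+1] n k)) ⟩
      suc k ℕ.* (suc n C suc k)                   ≡⟨ [1+k]*[1+n]C[1+k]≡[1+n]*nCk n k ⟩
      suc n ℕ.* (n C k)                           ∎

[1+k]*[n+1+k]C[1+k]≡[n+1+k]*[n+k]Ck : ∀ n k →
  ℕ→ℚ (suc k) * ℕ→ℚ ((n ℕ.+ suc k) C suc k) ≡ (ℕ→ℚ n + ℕ→ℚ (suc k)) * ℕ→ℚ ((n ℕ.+ k) C k)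
[1+k]*[n+1+k]C[1+k]≡[n+1+k]*[n+k]Ck n k = begin
  ℕ→ℚ (suc k) * ℕ→ℚ ((n ℕ.+ suc k) C suc k)       ≡⟨ ℕ→ℚ-* (suc k) ((n ℕ.+ suc k) C suc k) ⟨
  ℕ→ℚ (suc k ℕ.* ((n ℕ.+ suc k) C suc k))         ≡⟨ cong ℕ→ℚ absorption ⟩
  ℕ→ℚ ((n ℕ.+ suc k) ℕ.* ((n ℕ.+ k) C k))         ≡⟨ ℕ→ℚ-* (n ℕ.+ suc k) ((n ℕ.+ k) C k) ⟩
  ℕ→ℚ (n ℕ.+ suc k) * ℕ→ℚ ((n ℕ.+ k) C k)         ≡⟨ cong (_* ℕ→ℚ ((n ℕ.+ k) C k)) (ℕ→ℚ-+ n (suc k)) ⟩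
  (ℕ→ℚ n + ℕ→ℚ (suc k)) * ℕ→ℚ ((n ℕ.+ k) C k)     ∎
  where
  absorption : suc k ℕ.* ((n ℕ.+ suc k) C suc k) ≡ (n ℕ.+ suc k) ℕ.* ((n ℕ.+ k) C k)
  absorption rewrite ℕ.+-suc n k = [1+k]*[1+n]C[1+k]≡[1+n]*nCk (n ℕ.+ k) k

nC[1+a]≡-nCa*[1-[1+n]/[1+a]] : ∀ n a →
  ℕ→ℚ (n C suc a) ≡ (- 1ℚ) * ℕ→ℚ (n C a) * (1ℚ + - ℕ→ℚ (suc n) * (+ 1 / suc a))
nC[1+a]≡-nCa*[1-[1+n]/[1+a]] n a = ℕ→ℚ-*-cancelˡ (suc a) (begin
  A * ℕ→ℚ (n C suc a)                          ≡⟨ [1+k]*nC[1+k]≡[n-k]*nCk n a ⟩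
  (ν - A) * X                                  ≡⟨ cong (λ z → (z - A) * X) (ℚ.*-identityʳ ν) ⟨
  (ν * 1ℚ - A) * X                             ≡⟨ cong (λ z → (ν * z - A) * X) (1/n*n≡1 (suc a)) ⟨
  (ν * (+ 1 / suc a * A) - A) * X              ≡⟨ expand A ν X (+ 1 / suc a) ⟨
  A * ((- 1ℚ) * X * (1ℚ + - ν * (+ 1 / suc a))) ∎)
  where
  A = ℕ→ℚ (suc a)
  ν = ℕ→ℚ (suc n)
  X = ℕ→ℚ (n C a)
  expand : ∀ A ν X i → A * ((- 1ℚ) * X * (1ℚ + - ν * i)) ≡ (ν * (i * A) - A) * X
  expand = solve 4 (λ A ν X i →
    A :* (:- con 1ℚ :* X :* (con 1ℚ :+ :- ν :* i))
    := (ν :* (i :* A) :- A) :* X) refl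

[n+1+k]C[1+k]≡[n+k]Ck*[1+n/[1+k]] : ∀ n k →
  ℕ→ℚ ((n ℕ.+ suc k) C suc k) ≡ ℕ→ℚ ((n ℕ.+ k) C k) * (1ℚ + ℕ→ℚ n * (+ 1 / suc k))
[n+1+k]C[1+k]≡[n+k]Ck*[1+n/[1+k]] n k = ℕ→ℚ-*-cancelˡ (suc k) (begin
  K * ℕ→ℚ ((n ℕ.+ suc k) C suc k)              ≡⟨ [1+k]*[n+1+k]C[1+k]≡[n+1+k]*[n+k]Ck n k ⟩
  (ν + K) * X                                  ≡⟨ cong (λ z → (z + K) * X) (ℚ.*-identityʳ ν) ⟨
  (ν * 1ℚ + K) * X                             ≡⟨ cong (λ z → (ν * z + K) * X) (1/n*n≡1 (suc k)) ⟨
  (ν * (+ 1 / suc k * K) + K) * X              ≡⟨ expand K ν X (+ 1 / suc k) ⟨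
  K * (X * (1ℚ + ν * (+ 1 / suc k)))           ∎)
  where
  K = ℕ→ℚ (suc k)
  ν = ℕ→ℚ n
  X = ℕ→ℚ ((n ℕ.+ k) C k)
  expand : ∀ K ν X i → K * (X * (1ℚ + ν * i)) ≡ (ν * (i * K) + K) * X
  expand = solve 4 (λ K ν X i → K :* (X :* (con 1ℚ :+ ν :* i)) := (ν :* (i :* K) :+ K) :* X) refl

[m+n]Cm≡[m+n]Cn : ∀ m n → (m ℕ.+ n) C m ≡ (m ℕ.+ n) C n
[m+n]Cm≡[m+n]Cn m n = trans (nCk≡nC[n∸k] (ℕ.m≤m+n m n)) (cong ((m ℕ.+ n) C_) (ℕ.m+n∸m≡n m n))

module Digits (p : ℕ) .{{_ : NonZero p}} where

  1+a%p≡p⇒1+a≡[1+a/p]*p : ∀ a → suc (a ℕ.% p) ≡ p → suc a ≡ suc (a ℕ./ p) ℕ.* p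
  1+a%p≡p⇒1+a≡[1+a/p]*p a 1+a%p≡p = begin
    suc a                               ≡⟨ cong suc (m≡m%n+[m/n]*n a p) ⟩
    suc (a ℕ.% p) ℕ.+ a ℕ./ p ℕ.* p     ≡⟨ cong (ℕ._+ a ℕ./ p ℕ.* p) 1+a%p≡p ⟩
    suc (a ℕ./ p) ℕ.* p                 ∎

  p∣1+a⇒1+a≡[1+a/p]*p : ∀ a → p ∣ suc a → suc a ≡ suc (a ℕ./ p) ℕ.* p
  p∣1+a⇒1+a≡[1+a/p]*p a p∣1+a = 1+a%p≡p⇒1+a≡[1+a/p]*p a
    (trans (cong suc (%-pred-≡0 (n∣m⇒m%n≡0 (suc a) p p∣1+a))) (ℕ.m+[n∸m]≡n (ℕ.>-nonZero⁻¹ p)))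

  /-suc-∣ : ∀ a → p ∣ suc a → suc a ℕ./ p ≡ suc (a ℕ./ p)
  /-suc-∣ a p∣1+a = trans (cong (ℕ._/ p) (p∣1+a⇒1+a≡[1+a/p]*p a p∣1+a)) (m*n/n≡m (suc (a ℕ./ p)) p)

  /-suc-∤ : ∀ a → ¬ p ∣ suc a → suc a ℕ./ p ≡ a ℕ./ p
  /-suc-∤ a p∤1+a with ℕ.m≤n⇒m<n∨m≡n (m%n<n a p)
  ... | inj₂ 1+a%p≡p = contradiction (divides (suc (a ℕ./ p)) (1+a%p≡p⇒1+a≡[1+a/p]*p a 1+a%p≡p)) p∤1+a
  ... | inj₁ 1+a%p<p = begin
    suc a ℕ./ p                                         ≡⟨ cong (ℕ._/ p) (cong suc (m≡m%n+[m/n]*n a p)) ⟩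
    (suc (a ℕ.% p) ℕ.+ a ℕ./ p ℕ.* p) ℕ./ p             ≡⟨ +-distrib-/-∣ʳ (suc (a ℕ.% p)) (n∣m*n (a ℕ./ p)) ⟩
    suc (a ℕ.% p) ℕ./ p ℕ.+ a ℕ./ p ℕ.* p ℕ./ p         ≡⟨ cong₂ ℕ._+_ (m<n⇒m/n≡0 1+a%p<p) (m*n/n≡m (a ℕ./ p) p) ⟩
    a ℕ./ p                                             ∎

  [p*M+b]/p≡M+b/p : ∀ M b → (p ℕ.* M ℕ.+ b) ℕ./ p ≡ M ℕ.+ b ℕ./ p
  [p*M+b]/p≡M+b/p M b = trans (+-distrib-/-∣ˡ b (m∣m*n M))
    (cong (ℕ._+ b ℕ./ p) (trans (cong (ℕ._/ p) (ℕ.*-comm p M)) (m*n/n≡m M p)))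

∏[1+w/j] : ℕ → ℚ → ℕ → ℚ
∏[1+w/j] p w zero = 1ℚ
∏[1+w/j] p w (suc j) with p ∣? suc j
... | yes _ = ∏[1+w/j] p w j
... | no  _ = ∏[1+w/j] p w j * (1ℚ + w * (+ 1 / suc j))

∏-suc-∤ : ∀ p w j → ¬ p ∣ suc j → ∏[1+w/j] p w (suc j) ≡ ∏[1+w/j] p w j * (1ℚ + w * (+ 1 / suc j))
∏-suc-∤ p w j p∤1+j with p ∣? suc j
... | yes p∣1+j = contradiction p∣1+j p∤1+j
... | no  _     = refl

∏-suc-∣ : ∀ p w j → p ∣ suc j → ∏[1+w/j] p w (suc j) ≡ ∏[1+w/j] p w j
∏-suc-∣ p w j p∣1+j with p ∣? suc j
... | yes _     = refl
... | no p∤1+j  = contradiction p∣1+j p∤1+j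

module Factorisation (p : ℕ) .{{_ : NonZero p}} {M N : ℕ} (N≡pM : N ≡ p ℕ.* M) where

  open Digits p

  ν : ℚ
  ν = ℕ→ℚ N

  ν≡p*M : ν ≡ ℕ→ℚ p * ℕ→ℚ M
  ν≡p*M = trans (cong ℕ→ℚ N≡pM) (ℕ→ℚ-* p M)

  1+a≡[1+a/p]*p : ∀ {a} → p ∣ suc a → ℕ→ℚ (suc a) ≡ ℕ→ℚ (suc (a ℕ./ p)) * ℕ→ℚ p
  1+a≡[1+a/p]*p {a} p∣1+a = trans (cong ℕ→ℚ (p∣1+a⇒1+a≡[1+a/p]*p a p∣1+a)) (ℕ→ℚ-* (suc (a ℕ./ p)) p)

  [N∸1]C-factorises : ℕ → Set
  [N∸1]C-factorises a =
    ℕ→ℚ ((N ℕ.∸ 1) C a) ≡ (- 1ℚ) ^ᵠ (a ℕ.+ a ℕ./ p) * ℕ→ℚ ((M ℕ.∸ 1) C (a ℕ./ p)) * ∏[1+w/j] p (- ν) a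

  module _ (1≤M : 1 ≤ M) where

    1+[N∸1]≡N : suc (N ℕ.∸ 1) ≡ N
    1+[N∸1]≡N = ℕ.m+[n∸m]≡n (subst (1 ≤_) (sym N≡pM) (ℕ.*-mono-≤ (ℕ.>-nonZero⁻¹ p) 1≤M))

    [N-[1+a]]*[M∸1]Ck≡[1+a]*[M∸1]C[1+k] : ∀ {a} → p ∣ suc a →
      (ν - ℕ→ℚ (suc a)) * ℕ→ℚ ((M ℕ.∸ 1) C (a ℕ./ p)) ≡ ℕ→ℚ (suc a) * ℕ→ℚ ((M ℕ.∸ 1) C suc (a ℕ./ p))
    [N-[1+a]]*[M∸1]Ck≡[1+a]*[M∸1]C[1+k] {a} p∣1+a = begin
      (ν - ℕ→ℚ (suc a)) * B
        ≡⟨ cong₂ (λ x y → (x - y) * B) ν≡p*M (1+a≡[1+a/p]*p p∣1+a) ⟩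
      (ℕ→ℚ p * ℕ→ℚ M - ℕ→ℚ (suc k) * ℕ→ℚ p) * B
        ≡⟨ factor (ℕ→ℚ p) (ℕ→ℚ M) (ℕ→ℚ (suc k)) B ⟩
      ℕ→ℚ p * ((ℕ→ℚ M - ℕ→ℚ (suc k)) * B)
        ≡⟨ cong (λ x → ℕ→ℚ p * ((ℕ→ℚ x - ℕ→ℚ (suc k)) * B)) (ℕ.m+[n∸m]≡n 1≤M) ⟨
      ℕ→ℚ p * ((ℕ→ℚ (suc (M ℕ.∸ 1)) - ℕ→ℚ (suc k)) * B)
        ≡⟨ cong (ℕ→ℚ p *_) ([1+k]*nC[1+k]≡[n-k]*nCk (M ℕ.∸ 1) k) ⟨
      ℕ→ℚ p * (ℕ→ℚ (suc k) * B′)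
        ≡⟨ regroup (ℕ→ℚ p) (ℕ→ℚ (suc k)) B′ ⟩
      ℕ→ℚ (suc k) * ℕ→ℚ p * B′
        ≡⟨ cong (_* B′) (1+a≡[1+a/p]*p p∣1+a) ⟨
      ℕ→ℚ (suc a) * B′
        ∎
      where
      k = a ℕ./ p
      B = ℕ→ℚ ((M ℕ.∸ 1) C k)
      B′ = ℕ→ℚ ((M ℕ.∸ 1) C suc k)
      factor : ∀ p M k B → (p * M - k * p) * B ≡ p * ((M - k) * B)
      factor = solve 4 (λ p M k B → (p :* M :- k :* p) :* B := p :* ((M :- k) :* B)) refl
      regroup : ∀ p k B → p * (k * B) ≡ k * p * B
      regroup = solve 3 (λ p k B → p :* (k :* B) := k :* p :* B) refl

    [N∸1]C-factorises-suc-∤ : ∀ {a} → ¬ p ∣ suc a → [N∸1]C-factorises a → [N∸1]C-factorises (suc a)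
    [N∸1]C-factorises-suc-∤ {a} p∤1+a IH = begin
      ℕ→ℚ (K C suc a)
        ≡⟨ nC[1+a]≡-nCa*[1-[1+n]/[1+a]] K a ⟩
      (- 1ℚ) * ℕ→ℚ (K C a) * (1ℚ + - ℕ→ℚ (suc K) * i)
        ≡⟨ cong₂ (λ x y → (- 1ℚ) * y * (1ℚ + - ℕ→ℚ x * i)) 1+[N∸1]≡N IH ⟩
      (- 1ℚ) * (σ * B * P) * (1ℚ + - ν * i)
        ≡⟨ regroup σ B P (1ℚ + - ν * i) ⟩
      (- 1ℚ) * σ * B * (P * (1ℚ + - ν * i))
        ≡⟨ cong₂ (λ k P′ → (- 1ℚ) ^ᵠ (suc a ℕ.+ k) * ℕ→ℚ ((M ℕ.∸ 1) C k) * P′)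
           (/-suc-∤ a p∤1+a) (∏-suc-∤ p (- ν) a p∤1+a) ⟨
      (- 1ℚ) ^ᵠ (suc a ℕ.+ suc a ℕ./ p) * ℕ→ℚ ((M ℕ.∸ 1) C (suc a ℕ./ p)) * ∏[1+w/j] p (- ν) (suc a)
        ∎
      where
      K = N ℕ.∸ 1
      i = + 1 / suc a
      σ = (- 1ℚ) ^ᵠ (a ℕ.+ a ℕ./ p)
      B = ℕ→ℚ ((M ℕ.∸ 1) C (a ℕ./ p))
      P = ∏[1+w/j] p (- ν) a
      regroup : ∀ σ B P f → (- 1ℚ) * (σ * B * P) * f ≡ (- 1ℚ) * σ * B * (P * f)
      regroup = solve 4 (λ σ B P f → :- con 1ℚ :* (σ :* B :* P) :* f := :- con 1ℚ :* σ :* B :* (P :* f)) refl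

    [N∸1]C-factorises-suc-∣ : ∀ {a} → p ∣ suc a → [N∸1]C-factorises a → [N∸1]C-factorises (suc a)
    [N∸1]C-factorises-suc-∣ {a} p∣1+a IH = begin
      ℕ→ℚ (K C suc a)
        ≡⟨ ℕ→ℚ-*-cancelˡ (suc a) (begin
             A * ℕ→ℚ (K C suc a)                ≡⟨ [1+k]*nC[1+k]≡[n-k]*nCk K a ⟩
             (ℕ→ℚ (suc K) - A) * ℕ→ℚ (K C a)    ≡⟨ cong₂ (λ x y → (ℕ→ℚ x - A) * y) 1+[N∸1]≡N IH ⟩
             (ν - A) * (σ * B * P)              ≡⟨ pull σ B P (ν - A) ⟩
             σ * P * ((ν - A) * B)              ≡⟨ cong (σ * P *_) ([N-[1+a]]*[M∸1]Ck≡[1+a]*[M∸1]C[1+k] p∣1+a) ⟩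
             σ * P * (A * B′)                   ≡⟨ push σ P A B′ ⟩
             A * ((- 1ℚ) * ((- 1ℚ) * σ) * B′ * P) ∎) ⟩
      (- 1ℚ) * ((- 1ℚ) * σ) * B′ * P
        ≡⟨ cong (λ e → (- 1ℚ) * (- 1ℚ) ^ᵠ e * B′ * P) (ℕ.+-suc a k) ⟨
      (- 1ℚ) ^ᵠ (suc a ℕ.+ suc k) * B′ * P
        ≡⟨ cong₂ (λ k P′ → (- 1ℚ) ^ᵠ (suc a ℕ.+ k) * ℕ→ℚ ((M ℕ.∸ 1) C k) * P′)
                 (/-suc-∣ a p∣1+a) (∏-suc-∣ p (- ν) a p∣1+a) ⟨
      (- 1ℚ) ^ᵠ (suc a ℕ.+ suc a ℕ./ p) * ℕ→ℚ ((M ℕ.∸ 1) C (suc a ℕ./ p)) * ∏[1+w/j] p (- ν) (suc a)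
        ∎
      where
      K = N ℕ.∸ 1
      k = a ℕ./ p
      A = ℕ→ℚ (suc a)
      σ = (- 1ℚ) ^ᵠ (a ℕ.+ k)
      B = ℕ→ℚ ((M ℕ.∸ 1) C k)
      B′ = ℕ→ℚ ((M ℕ.∸ 1) C suc k)
      P = ∏[1+w/j] p (- ν) a
      pull : ∀ σ B P x → x * (σ * B * P) ≡ σ * P * (x * B)
      pull = solve 4 (λ σ B P x → x :* (σ :* B :* P) := σ :* P :* (x :* B)) refl
      push : ∀ σ P A B → σ * P * (A * B) ≡ A * ((- 1ℚ) * ((- 1ℚ) * σ) * B * P)
      push = solve 4 (λ σ P A B → σ :* P :* (A :* B) := A :* (:- con 1ℚ :* (:- con 1ℚ :* σ) :* B :* P)) refl

    [N∸1]C-factorisation : ∀ a → [N∸1]C-factorises a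
    [N∸1]C-factorisation zero = subst (λ k → 1ℚ ≡ (- 1ℚ) ^ᵠ k * ℕ→ℚ ((M ℕ.∸ 1) C k) * 1ℚ) (sym (0/n≡0 p)) refl
    [N∸1]C-factorisation (suc a) =
      [ [N∸1]C-factorises-suc-∣ , [N∸1]C-factorises-suc-∤ ]′ (toSum (p ∣? suc a)) ([N∸1]C-factorisation a)

  [N+b]Cb-factorises : ℕ → Set
  [N+b]Cb-factorises b = ℕ→ℚ ((N ℕ.+ b) C b) ≡ ℕ→ℚ ((M ℕ.+ b ℕ./ p) C (b ℕ./ p)) * ∏[1+w/j] p ν b

  [N+[1+b]]*[M+k]Ck≡[1+b]*[M+1+k]C[1+k] : ∀ {b} → p ∣ suc b →
    (ν + ℕ→ℚ (suc b)) * ℕ→ℚ ((M ℕ.+ b ℕ./ p) C (b ℕ./ p)) ≡ ℕ→ℚ (suc b) * ℕ→ℚ ((M ℕ.+ suc (b ℕ./ p)) C suc (b ℕ./ p))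
  [N+[1+b]]*[M+k]Ck≡[1+b]*[M+1+k]C[1+k] {b} p∣1+b = begin
    (ν + ℕ→ℚ (suc b)) * C′                        ≡⟨ cong₂ (λ x y → (x + y) * C′) ν≡p*M (1+a≡[1+a/p]*p p∣1+b) ⟩
    (ℕ→ℚ p * ℕ→ℚ M + ℕ→ℚ (suc k) * ℕ→ℚ p) * C′    ≡⟨ factor (ℕ→ℚ p) (ℕ→ℚ M) (ℕ→ℚ (suc k)) C′ ⟩
    ℕ→ℚ p * ((ℕ→ℚ M + ℕ→ℚ (suc k)) * C′)         ≡⟨ cong (ℕ→ℚ p *_) ([1+k]*[n+1+k]C[1+k]≡[n+1+k]*[n+k]Ck M k) ⟨
    ℕ→ℚ p * (ℕ→ℚ (suc k) * C″)                   ≡⟨ regroup (ℕ→ℚ p) (ℕ→ℚ (suc k)) C″ ⟩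
    ℕ→ℚ (suc k) * ℕ→ℚ p * C″                     ≡⟨ cong (_* C″) (1+a≡[1+a/p]*p p∣1+b) ⟨
    ℕ→ℚ (suc b) * C″                             ∎
    where
    k = b ℕ./ p
    C′ = ℕ→ℚ ((M ℕ.+ k) C k)
    C″ = ℕ→ℚ ((M ℕ.+ suc k) C suc k)
    factor : ∀ p M k C → (p * M + k * p) * C ≡ p * ((M + k) * C)
    factor = solve 4 (λ p M k C → (p :* M :+ k :* p) :* C := p :* ((M :+ k) :* C)) refl
    regroup : ∀ p k C → p * (k * C) ≡ k * p * C
    regroup = solve 3 (λ p k C → p :* (k :* C) := k :* p :* C) refl

  [N+b]Cb-factorises-suc-∤ : ∀ {b} → ¬ p ∣ suc b → [N+b]Cb-factorises b → [N+b]Cb-factorises (suc b)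
  [N+b]Cb-factorises-suc-∤ {b} p∤1+b IH = begin
    ℕ→ℚ ((N ℕ.+ suc b) C suc b)
      ≡⟨ [n+1+k]C[1+k]≡[n+k]Ck*[1+n/[1+k]] N b ⟩
    ℕ→ℚ ((N ℕ.+ b) C b) * (1ℚ + ν * i)
      ≡⟨ cong (_* (1ℚ + ν * i)) IH ⟩
    C′ * Q * (1ℚ + ν * i)
      ≡⟨ ℚ.*-assoc C′ Q (1ℚ + ν * i) ⟩
    C′ * (Q * (1ℚ + ν * i))
      ≡⟨ cong₂ (λ k Q′ → ℕ→ℚ ((M ℕ.+ k) C k) * Q′) (/-suc-∤ b p∤1+b) (∏-suc-∤ p ν b p∤1+b) ⟨
    ℕ→ℚ ((M ℕ.+ suc b ℕ./ p) C (suc b ℕ./ p)) * ∏[1+w/j] p ν (suc b)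
      ∎
    where
    i = + 1 / suc b
    C′ = ℕ→ℚ ((M ℕ.+ b ℕ./ p) C (b ℕ./ p))
    Q = ∏[1+w/j] p ν b

  [N+b]Cb-factorises-suc-∣ : ∀ {b} → p ∣ suc b → [N+b]Cb-factorises b → [N+b]Cb-factorises (suc b)
  [N+b]Cb-factorises-suc-∣ {b} p∣1+b IH = begin
    ℕ→ℚ ((N ℕ.+ suc b) C suc b)
      ≡⟨ ℕ→ℚ-*-cancelˡ (suc b) (begin
           B * ℕ→ℚ ((N ℕ.+ suc b) C suc b)   ≡⟨ [1+k]*[n+1+k]C[1+k]≡[n+1+k]*[n+k]Ck N b ⟩
           (ν + B) * ℕ→ℚ ((N ℕ.+ b) C b)     ≡⟨ cong ((ν + B) *_) IH ⟩
           (ν + B) * (C′ * Q)                ≡⟨ ℚ.*-assoc (ν + B) C′ Q ⟨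
           (ν + B) * C′ * Q                  ≡⟨ cong (_* Q) ([N+[1+b]]*[M+k]Ck≡[1+b]*[M+1+k]C[1+k] p∣1+b) ⟩
           B * C″ * Q                        ≡⟨ ℚ.*-assoc B C″ Q ⟩
           B * (C″ * Q)                      ∎) ⟩
    C″ * Q
      ≡⟨ cong₂ (λ k Q′ → ℕ→ℚ ((M ℕ.+ k) C k) * Q′) (/-suc-∣ b p∣1+b) (∏-suc-∣ p ν b p∣1+b) ⟨
    ℕ→ℚ ((M ℕ.+ suc b ℕ./ p) C (suc b ℕ./ p)) * ∏[1+w/j] p ν (suc b)
      ∎
    where
    k = b ℕ./ p
    B = ℕ→ℚ (suc b)
    C′ = ℕ→ℚ ((M ℕ.+ k) C k)
    C″ = ℕ→ℚ ((M ℕ.+ suc k) C suc k)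
    Q = ∏[1+w/j] p ν b

  [N+b]Cb-factorisation : ∀ b → [N+b]Cb-factorises b
  [N+b]Cb-factorisation zero = subst (λ k → 1ℚ ≡ ℕ→ℚ ((M ℕ.+ k) C k) * 1ℚ) (sym (0/n≡0 p)) refl
  [N+b]Cb-factorisation (suc b) =
    [ [N+b]Cb-factorises-suc-∣ , [N+b]Cb-factorises-suc-∤ ]′ (toSum (p ∣? suc b)) ([N+b]Cb-factorisation b)

  [N+b]CN-factorisation : ∀ b →
    ℕ→ℚ ((N ℕ.+ b) C N) ≡ ℕ→ℚ (((N ℕ.+ b) ℕ./ p) C M) * ∏[1+w/j] p ν b
  [N+b]CN-factorisation b = begin
    ℕ→ℚ ((N ℕ.+ b) C N)
      ≡⟨ cong ℕ→ℚ ([m+n]Cm≡[m+n]Cn N b) ⟩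
    ℕ→ℚ ((N ℕ.+ b) C b)
      ≡⟨ [N+b]Cb-factorisation b ⟩
    ℕ→ℚ ((M ℕ.+ b ℕ./ p) C (b ℕ./ p)) * Q
      ≡⟨ cong (λ x → ℕ→ℚ x * Q) ([m+n]Cm≡[m+n]Cn M (b ℕ./ p)) ⟨
    ℕ→ℚ ((M ℕ.+ b ℕ./ p) C M) * Q
      ≡⟨ cong (λ x → ℕ→ℚ (x C M) * Q) (trans (cong (λ n → (n ℕ.+ b) ℕ./ p) N≡pM) ([p*M+b]/p≡M+b/p M b)) ⟨
    ℕ→ℚ (((N ℕ.+ b) ℕ./ p) C M) * Q
      ∎
    where
    Q = ∏[1+w/j] p ν b

H-suc-∤ : ∀ p j → ¬ p ∣ suc j → H p (suc j) ≡ H p j + + 1 / suc j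
H-suc-∤ p j p∤1+j with p ∣? suc j
... | yes p∣1+j = contradiction p∣1+j p∤1+j
... | no  _     = refl

H-suc-∣ : ∀ p j → p ∣ suc j → H p (suc j) ≡ H p j
H-suc-∣ p j p∣1+j with p ∣? suc j
... | yes _     = refl
... | no p∤1+j  = contradiction p∣1+j p∤1+j

module PAdic (p : ℕ) (p-prime : Prime p) where

  -- x ∈ p^k ℤ₍ₚ₎. ModEq p k x y is the Σ-type of p^k∣z⇒∃ at z = x - y; the record
  -- (unlike that Σ-type) lets Agda infer k and x.
  infix 4 p^_∣_
  record p^_∣_ (k : ℕ) (x : ℚ) : Set where
    constructor mk∣
    field
      numerator     : ℤ
      denominator   : ℕ
      p∤denominator : ¬ p ∣ denominator
      equation      : x * ℕ→ℚ denominator ≡ ℕ→ℚ (p ℕ.^ k) * ℤ→ℚ numerator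

  p^k∣z⇒∃ : ∀ {k z} → p^ k ∣ z → ∃[ u ] ∃[ v ] (¬ p ∣ v) × (z * ℕ→ℚ v ≡ ℕ→ℚ (p ℕ.^ k) * ℤ→ℚ u)
  p^k∣z⇒∃ (mk∣ u v p∤v e) = u , v , p∤v , e

  Integral : ℚ → Set
  Integral x = p^ 0 ∣ x

  p∤1 : ¬ p ∣ 1
  p∤1 p∣1 = ¬prime[1] (subst Prime (∣1⇒≡1 p∣1) p-prime)

  p∤-* : ∀ {m n} → ¬ p ∣ m → ¬ p ∣ n → ¬ p ∣ m ℕ.* n
  p∤-* {m} {n} p∤m p∤n p∣mn = [ p∤m , p∤n ]′ (euclidsLemma m n p-prime p∣mn)

  ∣-0 : ∀ {k} → p^ k ∣ 0ℚ
  ∣-0 {k} = mk∣ (+ 0) 1 p∤1 (trans (ℚ.*-zeroˡ 1ℚ) (sym (ℚ.*-zeroʳ (ℕ→ℚ (p ℕ.^ k)))))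

  ∣-ℤ : ∀ u → Integral (ℤ→ℚ u)
  ∣-ℤ u = mk∣ u 1 p∤1 (ℚ.*-comm (ℤ→ℚ u) 1ℚ)

  ∣-ℕ : ∀ n → Integral (ℕ→ℚ n)
  ∣-ℕ n = ∣-ℤ (+ n)

  ∣-1/n : ∀ {n} .{{_ : NonZero n}} → ¬ p ∣ n → Integral (+ 1 / n)
  ∣-1/n {n} p∤n = mk∣ (+ 1) n p∤n (1/n*n≡1 n)

  ∣-+ : ∀ {k x y} → p^ k ∣ x → p^ k ∣ y → p^ k ∣ (x + y)
  ∣-+ {k} {x} {y} (mk∣ u₁ v₁ p∤v₁ e₁) (mk∣ u₂ v₂ p∤v₂ e₂) =
    mk∣ (u₁ ℤ.* + v₂ ℤ.+ u₂ ℤ.* + v₁) (v₁ ℕ.* v₂) (p∤-* p∤v₁ p∤v₂) (begin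
      (x + y) * ℕ→ℚ (v₁ ℕ.* v₂)           ≡⟨ cong ((x + y) *_) (ℕ→ℚ-* v₁ v₂) ⟩
      (x + y) * (V₁ * V₂)                 ≡⟨ distrib x y V₁ V₂ ⟩
      x * V₁ * V₂ + y * V₂ * V₁           ≡⟨ cong₂ (λ a b → a * V₂ + b * V₁) e₁ e₂ ⟩
      P * U₁ * V₂ + P * U₂ * V₁           ≡⟨ factor P U₁ V₂ U₂ V₁ ⟩
      P * (U₁ * V₂ + U₂ * V₁)             ≡⟨ cong (P *_) (cong₂ _+_ (ℤ→ℚ-* u₁ (+ v₂)) (ℤ→ℚ-* u₂ (+ v₁))) ⟨
      P * (ℤ→ℚ (u₁ ℤ.* + v₂) + ℤ→ℚ (u₂ ℤ.* + v₁)) ≡⟨ cong (P *_) (ℤ→ℚ-+ (u₁ ℤ.* + v₂) (u₂ ℤ.* + v₁)) ⟨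
      P * ℤ→ℚ (u₁ ℤ.* + v₂ ℤ.+ u₂ ℤ.* + v₁) ∎)
    where
    P = ℕ→ℚ (p ℕ.^ k)
    U₁ = ℤ→ℚ u₁
    U₂ = ℤ→ℚ u₂
    V₁ = ℕ→ℚ v₁
    V₂ = ℕ→ℚ v₂
    distrib : ∀ x y a b → (x + y) * (a * b) ≡ x * a * b + y * b * a
    distrib = solve 4 (λ x y a b → (x :+ y) :* (a :* b) := x :* a :* b :+ y :* b :* a) refl
    factor : ∀ P a b c d → P * a * b + P * c * d ≡ P * (a * b + c * d)
    factor = solve 5 (λ P a b c d → P :* a :* b :+ P :* c :* d := P :* (a :* b :+ c :* d)) refl

  ∣-neg : ∀ {k x} → p^ k ∣ x → p^ k ∣ (- x)
  ∣-neg {k} {x} (mk∣ u v p∤v e) = mk∣ (ℤ.- u) v p∤v (begin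
    - x * ℕ→ℚ v                  ≡⟨ ℚ.neg-distribˡ-* x (ℕ→ℚ v) ⟨
    - (x * ℕ→ℚ v)                ≡⟨ cong -_ e ⟩
    - (ℕ→ℚ (p ℕ.^ k) * ℤ→ℚ u)    ≡⟨ ℚ.neg-distribʳ-* (ℕ→ℚ (p ℕ.^ k)) (ℤ→ℚ u) ⟩
    ℕ→ℚ (p ℕ.^ k) * - ℤ→ℚ u      ≡⟨ cong (ℕ→ℚ (p ℕ.^ k) *_) (ℤ→ℚ-neg u) ⟨
    ℕ→ℚ (p ℕ.^ k) * ℤ→ℚ (ℤ.- u)  ∎)

  ∣-* : ∀ {k l x y} → p^ k ∣ x → p^ l ∣ y → p^ (k ℕ.+ l) ∣ (x * y)
  ∣-* {k} {l} {x} {y} (mk∣ u₁ v₁ p∤v₁ e₁) (mk∣ u₂ v₂ p∤v₂ e₂) =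
    mk∣ (u₁ ℤ.* u₂) (v₁ ℕ.* v₂) (p∤-* p∤v₁ p∤v₂) (begin
      x * y * ℕ→ℚ (v₁ ℕ.* v₂)
        ≡⟨ cong (x * y *_) (ℕ→ℚ-* v₁ v₂) ⟩
      x * y * (ℕ→ℚ v₁ * ℕ→ℚ v₂)
        ≡⟨ interchange x y (ℕ→ℚ v₁) (ℕ→ℚ v₂) ⟩
      x * ℕ→ℚ v₁ * (y * ℕ→ℚ v₂)
        ≡⟨ cong₂ _*_ e₁ e₂ ⟩
      ℕ→ℚ (p ℕ.^ k) * ℤ→ℚ u₁ * (ℕ→ℚ (p ℕ.^ l) * ℤ→ℚ u₂)
        ≡⟨ interchange (ℕ→ℚ (p ℕ.^ k)) (ℤ→ℚ u₁) (ℕ→ℚ (p ℕ.^ l)) (ℤ→ℚ u₂) ⟩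
      ℕ→ℚ (p ℕ.^ k) * ℕ→ℚ (p ℕ.^ l) * (ℤ→ℚ u₁ * ℤ→ℚ u₂)
        ≡⟨ cong₂ _*_ (ℕ→ℚ-* (p ℕ.^ k) (p ℕ.^ l)) (ℤ→ℚ-* u₁ u₂) ⟨
      ℕ→ℚ (p ℕ.^ k ℕ.* p ℕ.^ l) * ℤ→ℚ (u₁ ℤ.* u₂)
        ≡⟨ cong (λ n → ℕ→ℚ n * ℤ→ℚ (u₁ ℤ.* u₂)) (ℕ.^-distribˡ-+-* p k l) ⟨
      ℕ→ℚ (p ℕ.^ (k ℕ.+ l)) * ℤ→ℚ (u₁ ℤ.* u₂)
        ∎)
    where
    interchange : ∀ a b c d → a * b * (c * d) ≡ a * c * (b * d)
    interchange = solve 4 (λ a b c d → a :* b :* (c :* d) := a :* c :* (b :* d)) refl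

  ∣-*-integralʳ : ∀ {k x y} → p^ k ∣ x → Integral y → p^ k ∣ (x * y)
  ∣-*-integralʳ {k} p^k∣x y-integral = subst (p^_∣ _) (ℕ.+-identityʳ k) (∣-* p^k∣x y-integral)

  ∣-weaken : ∀ {j k x} → j ≤ k → p^ k ∣ x → p^ j ∣ x
  ∣-weaken {j} {k} {x} j≤k (mk∣ u v p∤v e) with ℕ.m≤n⇒∃[o]m+o≡n j≤k
  ... | d , refl = mk∣ (u ℤ.* + (p ℕ.^ d)) v p∤v (begin
    x * ℕ→ℚ v                                     ≡⟨ e ⟩
    ℕ→ℚ (p ℕ.^ (j ℕ.+ d)) * ℤ→ℚ u                 ≡⟨ cong (λ n → ℕ→ℚ n * ℤ→ℚ u) (ℕ.^-distribˡ-+-* p j d) ⟩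
    ℕ→ℚ (p ℕ.^ j ℕ.* p ℕ.^ d) * ℤ→ℚ u             ≡⟨ cong (_* ℤ→ℚ u) (ℕ→ℚ-* (p ℕ.^ j) (p ℕ.^ d)) ⟩
    ℕ→ℚ (p ℕ.^ j) * ℕ→ℚ (p ℕ.^ d) * ℤ→ℚ u         ≡⟨ swap (ℕ→ℚ (p ℕ.^ j)) (ℕ→ℚ (p ℕ.^ d)) (ℤ→ℚ u) ⟩
    ℕ→ℚ (p ℕ.^ j) * (ℤ→ℚ u * ℕ→ℚ (p ℕ.^ d))       ≡⟨ cong (ℕ→ℚ (p ℕ.^ j) *_) (ℤ→ℚ-* u (+ (p ℕ.^ d))) ⟨
    ℕ→ℚ (p ℕ.^ j) * ℤ→ℚ (u ℤ.* + (p ℕ.^ d))       ∎)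
    where
    swap : ∀ a b c → a * b * c ≡ a * (c * b)
    swap = solve 3 (λ a b c → a :* b :* c := a :* (c :* b)) refl

  ∣x*v⇒∣x : ∀ {k x v} → ¬ p ∣ v → p^ k ∣ (x * ℕ→ℚ v) → p^ k ∣ x
  ∣x*v⇒∣x {k} {x} {v} p∤v (mk∣ u w p∤w e) = mk∣ u (v ℕ.* w) (p∤-* p∤v p∤w)
    (trans (cong (x *_) (ℕ→ℚ-* v w)) (trans (sym (ℚ.*-assoc x (ℕ→ℚ v) (ℕ→ℚ w))) e))

  mod-refl : ∀ {k} x → p^ k ∣ (x - x)
  mod-refl {k} x = subst (p^ k ∣_) (sym (ℚ.+-inverseʳ x)) ∣-0

  mod-trans : ∀ {k x y z} → p^ k ∣ (x - y) → p^ k ∣ (y - z) → p^ k ∣ (x - z)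
  mod-trans {k} {x} {y} {z} x≡y y≡z = subst (p^ k ∣_) (telescope x y z) (∣-+ x≡y y≡z)
    where
    telescope : ∀ x y z → x - y + (y - z) ≡ x - z
    telescope = solve 3 (λ x y z → x :- y :+ (y :- z) := x :- z) refl

  mod-*ˡ : ∀ {k x y} z → Integral z → p^ k ∣ (x - y) → p^ k ∣ (z * x - z * y)
  mod-*ˡ {k} {x} {y} z z-integral x≡y = subst (p^ k ∣_) (*-distribˡ-- z x y) (∣-* z-integral x≡y)
    where
    *-distribˡ-- : ∀ z x y → z * (x - y) ≡ z * x - z * y
    *-distribˡ-- = solve 3 (λ z x y → z :* (x :- y) := z :* x :- z :* y) refl

  ∣-^ᵠ : ∀ {x} → Integral x → ∀ r → Integral (x ^ᵠ r)
  ∣-^ᵠ x-integral zero    = ∣-ℕ 1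
  ∣-^ᵠ x-integral (suc r) = ∣-* x-integral (∣-^ᵠ x-integral r)

  ∣⇒p^∣ : ∀ {k n} → p ℕ.^ k ∣ n → p^ k ∣ ℕ→ℚ n
  ∣⇒p^∣ {k} (divides d refl) = mk∣ (+ d) 1 p∤1
    (trans (ℚ.*-identityʳ (ℕ→ℚ (d ℕ.* p ℕ.^ k))) (trans (ℕ→ℚ-* d (p ℕ.^ k)) (ℚ.*-comm (ℕ→ℚ d) (ℕ→ℚ (p ℕ.^ k)))))

  ∣-p : p^ 1 ∣ ℕ→ℚ p
  ∣-p = ∣⇒p^∣ (∣-reflexive (ℕ.*-identityʳ p))

  1/a+1/b : ∀ {k a b} .{{_ : NonZero a}} .{{_ : NonZero b}} → ¬ p ∣ a → ¬ p ∣ b →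
            p^ k ∣ (ℕ→ℚ a + ℕ→ℚ b) → p^ k ∣ (+ 1 / a + + 1 / b)
  1/a+1/b {k} {a} {b} p∤a p∤b p^k∣a+b = ∣x*v⇒∣x (p∤-* p∤a p∤b) (subst (p^ k ∣_) (sym (begin
    (+ 1 / a + + 1 / b) * ℕ→ℚ (a ℕ.* b)                      ≡⟨ cong ((+ 1 / a + + 1 / b) *_) (ℕ→ℚ-* a b) ⟩
    (+ 1 / a + + 1 / b) * (ℕ→ℚ a * ℕ→ℚ b)                    ≡⟨ expand (+ 1 / a) (+ 1 / b) (ℕ→ℚ a) (ℕ→ℚ b) ⟩
    ℕ→ℚ b * (+ 1 / a * ℕ→ℚ a) + ℕ→ℚ a * (+ 1 / b * ℕ→ℚ b)    ≡⟨ cong₂ (λ s t → ℕ→ℚ b * s + ℕ→ℚ a * t) (1/n*n≡1 a) (1/n*n≡1 b) ⟩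
    ℕ→ℚ b * 1ℚ + ℕ→ℚ a * 1ℚ                                  ≡⟨ simplify (ℕ→ℚ a) (ℕ→ℚ b) ⟩
    ℕ→ℚ a + ℕ→ℚ b                                            ∎)) p^k∣a+b)
    where
    expand : ∀ i j a b → (i + j) * (a * b) ≡ b * (i * a) + a * (j * b)
    expand = solve 4 (λ i j a b → (i :+ j) :* (a :* b) := b :* (i :* a) :+ a :* (j :* b)) refl
    simplify : ∀ a b → b * 1ℚ + a * 1ℚ ≡ a + b
    simplify = solve 2 (λ a b → b :* con 1ℚ :+ a :* con 1ℚ := a :+ b) refl

  1/a-1/b : ∀ {k a b} .{{_ : NonZero a}} .{{_ : NonZero b}} → ¬ p ∣ a → ¬ p ∣ b →
            p^ k ∣ (ℕ→ℚ b - ℕ→ℚ a) → p^ k ∣ (+ 1 / a - + 1 / b)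
  1/a-1/b {k} {a} {b} p∤a p∤b p^k∣b-a = ∣x*v⇒∣x (p∤-* p∤a p∤b) (subst (p^ k ∣_) (sym (begin
    (+ 1 / a - + 1 / b) * ℕ→ℚ (a ℕ.* b)                      ≡⟨ cong ((+ 1 / a - + 1 / b) *_) (ℕ→ℚ-* a b) ⟩
    (+ 1 / a - + 1 / b) * (ℕ→ℚ a * ℕ→ℚ b)                    ≡⟨ expand (+ 1 / a) (+ 1 / b) (ℕ→ℚ a) (ℕ→ℚ b) ⟩
    ℕ→ℚ b * (+ 1 / a * ℕ→ℚ a) - ℕ→ℚ a * (+ 1 / b * ℕ→ℚ b)    ≡⟨ cong₂ (λ s t → ℕ→ℚ b * s - ℕ→ℚ a * t) (1/n*n≡1 a) (1/n*n≡1 b) ⟩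
    ℕ→ℚ b * 1ℚ - ℕ→ℚ a * 1ℚ                                  ≡⟨ simplify (ℕ→ℚ a) (ℕ→ℚ b) ⟩
    ℕ→ℚ b - ℕ→ℚ a                                            ∎)) p^k∣b-a)
    where
    expand : ∀ i j a b → (i - j) * (a * b) ≡ b * (i * a) - a * (j * b)
    expand = solve 4 (λ i j a b → (i :- j) :* (a :* b) := b :* (i :* a) :- a :* (j :* b)) refl
    simplify : ∀ a b → b * 1ℚ - a * 1ℚ ≡ b - a
    simplify = solve 2 (λ a b → b :* con 1ℚ :- a :* con 1ℚ := b :- a) refl

  H-integral : ∀ a → Integral (H p a)
  H-integral zero = ∣-0
  H-integral (suc j) with p ∣? suc j
  ... | yes _    = H-integral j
  ... | no p∤1+j = ∣-+ (H-integral j) (∣-1/n p∤1+j)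

  -- Pairing j with p - j: 1/j + 1/(p - j) = p / (j (p - j)).
  H-reflection : ∀ x y → suc (x ℕ.+ y) ≡ p → p^ 1 ∣ (H p x + (H p (x ℕ.+ y) - H p y))
  H-reflection zero    y _ = subst (p^ 1 ∣_) (sym (0+[h-h]≡0 (H p y))) ∣-0
    where
    0+[h-h]≡0 : ∀ h → 0ℚ + (h - h) ≡ 0ℚ
    0+[h-h]≡0 = solve 1 (λ h → con 0ℚ :+ (h :- h) := con 0ℚ) refl
  H-reflection (suc x) y 2+x+y≡p = subst (p^ 1 ∣_) regroup (∣-+ IH pair)
    where
    p∤1+x : ¬ p ∣ suc x
    p∤1+x = >⇒∤ (subst (suc x <_) 2+x+y≡p (s≤s (s≤s (ℕ.m≤m+n x y))))
    p∤1+y : ¬ p ∣ suc y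
    p∤1+y = >⇒∤ (subst (suc y <_) 2+x+y≡p (s≤s (s≤s (ℕ.m≤n+m y x))))
    IH : p^ 1 ∣ (H p x + (H p (x ℕ.+ suc y) - H p (suc y)))
    IH = H-reflection x (suc y) (trans (cong suc (ℕ.+-suc x y)) 2+x+y≡p)
    pair : p^ 1 ∣ (+ 1 / suc x + + 1 / suc y)
    pair = 1/a+1/b p∤1+x p∤1+y (subst (p^ 1 ∣_) (ℕ→ℚ-+ (suc x) (suc y))
             (subst (λ n → p^ 1 ∣ ℕ→ℚ n) (sym (trans (ℕ.+-suc (suc x) y) 2+x+y≡p)) ∣-p))
    shuffle : ∀ hx hxy hy ix iy → hx + (hxy - (hy + iy)) + (ix + iy) ≡ hx + ix + (hxy - hy)
    shuffle = solve 5 (λ hx hxy hy ix iy →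
      hx :+ (hxy :- (hy :+ iy)) :+ (ix :+ iy)
      := hx :+ ix :+ (hxy :- hy)) refl
    regroup : H p x + (H p (x ℕ.+ suc y) - H p (suc y)) + (+ 1 / suc x + + 1 / suc y)
              ≡ H p (suc x) + (H p (suc x ℕ.+ y) - H p y)
    regroup = begin
      H p x + (H p (x ℕ.+ suc y) - H p (suc y)) + (+ 1 / suc x + + 1 / suc y)
        ≡⟨ cong₂ (λ n h → H p x + (H p n - h) + (+ 1 / suc x + + 1 / suc y)) (ℕ.+-suc x y) (H-suc-∤ p y p∤1+y) ⟩
      H p x + (H p (suc x ℕ.+ y) - (H p y + + 1 / suc y)) + (+ 1 / suc x + + 1 / suc y)
        ≡⟨ shuffle (H p x) (H p (suc x ℕ.+ y)) (H p y) (+ 1 / suc x) (+ 1 / suc y) ⟩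
      H p x + + 1 / suc x + (H p (suc x ℕ.+ y) - H p y)
        ≡⟨ cong (_+ (H p (suc x ℕ.+ y) - H p y)) (H-suc-∤ p x p∤1+x) ⟨
      H p (suc x) + (H p (suc x ℕ.+ y) - H p y)
        ∎

  module _ (p∤2 : ¬ p ∣ 2) where

    p∣H[p] : p^ 1 ∣ H p p
    p∣H[p] = subst (λ n → p^ 1 ∣ H p n) 1+q≡p
      (subst (p^ 1 ∣_) (sym (H-suc-∣ p q (subst (p ∣_) (sym 1+q≡p) ∣-refl))) p∣H[q])
      where
      q = ℕ.pred p
      1+q≡p : suc q ≡ p
      1+q≡p = ℕ.suc-pred p ⦃ prime⇒nonZero p-prime ⦄
      double : ∀ h → h + (h - 0ℚ) ≡ h * (1ℚ + 1ℚ)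
      double = solve 1 (λ h → h :+ (h :- con 0ℚ) := h :* (con 1ℚ :+ con 1ℚ)) refl
      p∣2H[q] : p^ 1 ∣ (H p q * ℕ→ℚ 2)
      p∣2H[q] = subst (p^ 1 ∣_) (trans (cong (λ n → H p q + (H p n - 0ℚ)) (ℕ.+-identityʳ q)) (double (H p q)))
                  (H-reflection q 0 (trans (cong suc (ℕ.+-identityʳ q)) 1+q≡p))
      p∣H[q] : p^ 1 ∣ H p q
      p∣H[q] = ∣x*v⇒∣x p∤2 p∣2H[q]

    H-periodic : ∀ y → p^ 1 ∣ (H p (y ℕ.+ p) - H p y)
    H-periodic zero = subst (p^ 1 ∣_) (h≡h-0 (H p p)) p∣H[p]
      where
      h≡h-0 : ∀ h → h ≡ h - 0ℚ
      h≡h-0 = solve 1 (λ h → h := h :- con 0ℚ) refl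
    H-periodic (suc y) with p ∣? suc y
    ... | yes p∣1+y =
      subst (λ h → p^ 1 ∣ (h - H p y)) (sym (H-suc-∣ p (y ℕ.+ p) (∣m∣n⇒∣m+n p∣1+y ∣-refl))) (H-periodic y)
    ... | no p∤1+y = subst (p^ 1 ∣_) regroup (∣-+ (H-periodic y) shift)
      where
      p∤1+y+p : ¬ p ∣ suc y ℕ.+ p
      p∤1+y+p p∣1+y+p = p∤1+y (∣m+n∣m⇒∣n (subst (p ∣_) (ℕ.+-comm (suc y) p) p∣1+y+p) ∣-refl)
      shift : p^ 1 ∣ (+ 1 / (suc y ℕ.+ p) - + 1 / suc y)
      shift = 1/a-1/b p∤1+y+p p∤1+y (subst (p^ 1 ∣_) (sym 1+y-[1+y+p]≡-p) (∣-neg ∣-p))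
        where
        a-[a+b]≡-b : ∀ a b → a - (a + b) ≡ - b
        a-[a+b]≡-b = solve 2 (λ a b → a :- (a :+ b) := :- b) refl
        1+y-[1+y+p]≡-p : ℕ→ℚ (suc y) - ℕ→ℚ (suc y ℕ.+ p) ≡ - ℕ→ℚ p
        1+y-[1+y+p]≡-p = trans (cong (λ z → ℕ→ℚ (suc y) - z) (ℕ→ℚ-+ (suc y) p)) (a-[a+b]≡-b (ℕ→ℚ (suc y)) (ℕ→ℚ p))
      shuffle : ∀ h h′ i i′ → h′ - h + (i′ - i) ≡ h′ + i′ - (h + i)
      shuffle = solve 4 (λ h h′ i i′ → h′ :- h :+ (i′ :- i) := h′ :+ i′ :- (h :+ i)) refl
      regroup : H p (y ℕ.+ p) - H p y + (+ 1 / (suc y ℕ.+ p) - + 1 / suc y) ≡ H p (suc y ℕ.+ p) - (H p y + + 1 / suc y)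
      regroup = trans (shuffle (H p y) (H p (y ℕ.+ p)) (+ 1 / suc y) (+ 1 / (suc y ℕ.+ p)))
                      (cong (_- (H p y + + 1 / suc y)) (sym (H-suc-∤ p (y ℕ.+ p) p∤1+y+p)))

    H-periodic-* : ∀ t y → p^ 1 ∣ (H p (p ℕ.* t ℕ.+ y) - H p y)
    H-periodic-* zero    y = subst (λ n → p^ 1 ∣ (H p (n ℕ.+ y) - H p y)) (sym (ℕ.*-zeroʳ p)) (mod-refl (H p y))
    H-periodic-* (suc t) y = mod-trans {x = H p (p ℕ.* suc t ℕ.+ y)} {y = H p (p ℕ.* t ℕ.+ y)} {z = H p y}
      (subst (λ n → p^ 1 ∣ (H p n - H p (p ℕ.* t ℕ.+ y))) (index p t y) (H-periodic (p ℕ.* t ℕ.+ y)))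
      (H-periodic-* t y)
      where
      index : ∀ p t y → p ℕ.* t ℕ.+ y ℕ.+ p ≡ p ℕ.* suc t ℕ.+ y
      index = ℕ-Solver.solve-∀

  ∏[1+w/j]≡1+w*H : ∀ {m w} → p^ m ∣ w → ∀ a → p^ (m ℕ.+ m) ∣ (∏[1+w/j] p w a - (1ℚ + w * H p a))
  ∏[1+w/j]≡1+w*H {m} {w} p^m∣w zero = subst (p^ (m ℕ.+ m) ∣_) (sym (1-[1+w*0]≡0 w)) ∣-0
    where
    1-[1+w*0]≡0 : ∀ w → 1ℚ - (1ℚ + w * 0ℚ) ≡ 0ℚ
    1-[1+w*0]≡0 = solve 1 (λ w → con 1ℚ :- (con 1ℚ :+ w :* con 0ℚ) := con 0ℚ) refl
  ∏[1+w/j]≡1+w*H {m} {w} p^m∣w (suc j) with p ∣? suc j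
  ... | yes _    = ∏[1+w/j]≡1+w*H p^m∣w j
  ... | no p∤1+j = subst (p^ (m ℕ.+ m) ∣_) (step (∏[1+w/j] p w j) (H p j) (+ 1 / suc j) w)
      (∣-+ (∣-*-integralʳ (∏[1+w/j]≡1+w*H p^m∣w j) (∣-+ (∣-ℕ 1) (∣-* (∣-weaken z≤n p^m∣w) (∣-1/n p∤1+j))))
           (∣-*-integralʳ (∣-* p^m∣w p^m∣w) (∣-* (H-integral j) (∣-1/n p∤1+j))))
    where
    step : ∀ g h i w → (g - (1ℚ + w * h)) * (1ℚ + w * i) + w * w * (h * i) ≡ g * (1ℚ + w * i) - (1ℚ + w * (h + i))
    step = solve 4 (λ g h i w →
      (g :- (con 1ℚ :+ w :* h)) :* (con 1ℚ :+ w :* i) :+ w :* w :* (h :* i)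
      := g :* (con 1ℚ :+ w :* i) :- (con 1ℚ :+ w :* (h :+ i))) refl

  -- k ≤ 2m is what makes the ν² terms of products negligible.
  module NearOne {m k : ℕ} (k≤m+m : k ≤ m ℕ.+ m) {ν : ℚ} (p^m∣ν : p^ m ∣ ν) where

    infix 4 _≈1+ν*_
    _≈1+ν*_ : ℚ → ℚ → Set
    Y ≈1+ν* h = p^ k ∣ (Y - (1ℚ + ν * h))

    1+ν*h-integral : ∀ {h} → Integral h → Integral (1ℚ + ν * h)
    1+ν*h-integral h-integral = ∣-+ (∣-ℕ 1) (∣-* (∣-weaken z≤n p^m∣ν) h-integral)

    ≈1+ν*⇒integral : ∀ {Y h} → Integral h → Y ≈1+ν* h → Integral Y
    ≈1+ν*⇒integral {Y} {h} h-integral Y≈ = subst Integral (sub-add Y (1ℚ + ν * h))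
      (∣-+ (∣-weaken z≤n Y≈) (1+ν*h-integral h-integral))
      where
      sub-add : ∀ x y → x - y + y ≡ x
      sub-add = solve 2 (λ x y → x :- y :+ y := x) refl

    ≈1+ν*-* : ∀ {Y₁ Y₂ h₁ h₂} → Integral h₁ → Integral h₂ → Y₁ ≈1+ν* h₁ → Y₂ ≈1+ν* h₂ → Y₁ * Y₂ ≈1+ν* (h₁ + h₂)
    ≈1+ν*-* {Y₁} {Y₂} {h₁} {h₂} h₁-integral h₂-integral Y₁≈ Y₂≈ = subst (p^ k ∣_) (expand Y₁ Y₂ h₁ h₂ ν)
      (∣-+ (∣-+ (∣-*-integralʳ Y₁≈ (≈1+ν*⇒integral h₂-integral Y₂≈)) (∣-* (1+ν*h-integral h₁-integral) Y₂≈))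
           (∣-weaken k≤m+m (∣-*-integralʳ (∣-* p^m∣ν p^m∣ν) (∣-* h₁-integral h₂-integral))))
      where
      expand : ∀ Y₁ Y₂ h₁ h₂ ν → (Y₁ - (1ℚ + ν * h₁)) * Y₂ + (1ℚ + ν * h₁) * (Y₂ - (1ℚ + ν * h₂)) + ν * ν * (h₁ * h₂)
                                 ≡ Y₁ * Y₂ - (1ℚ + ν * (h₁ + h₂))
      expand = solve 5 (λ Y₁ Y₂ h₁ h₂ ν →
        (Y₁ :- (con 1ℚ :+ ν :* h₁)) :* Y₂ :+ (con 1ℚ :+ ν :* h₁) :* (Y₂ :- (con 1ℚ :+ ν :* h₂)) :+ ν :* ν :* (h₁ :* h₂)
        := Y₁ :* Y₂ :- (con 1ℚ :+ ν :* (h₁ :+ h₂))) refl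

    ≈1+ν*-^ : ∀ {Y h} → Integral h → Y ≈1+ν* h → ∀ r → Y ^ᵠ r ≈1+ν* (ℕ→ℚ r * h)
    ≈1+ν*-^ {Y} {h} h-integral Y≈ zero = subst (p^ k ∣_) (sym (1-[1+ν*[0*h]]≡0 ν h)) ∣-0
      where
      1-[1+ν*[0*h]]≡0 : ∀ ν h → 1ℚ - (1ℚ + ν * (0ℚ * h)) ≡ 0ℚ
      1-[1+ν*[0*h]]≡0 = solve 2 (λ ν h → con 1ℚ :- (con 1ℚ :+ ν :* (con 0ℚ :* h)) := con 0ℚ) refl
    ≈1+ν*-^ {Y} {h} h-integral Y≈ (suc r) = subst (λ g → Y * Y ^ᵠ r ≈1+ν* g) h+r*h≡[1+r]*h
      (≈1+ν*-* {Y} {Y ^ᵠ r} h-integral (∣-* (∣-ℕ r) h-integral) Y≈ (≈1+ν*-^ {Y} h-integral Y≈ r))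
      where
      distrib : ∀ h r → h + r * h ≡ (1ℚ + r) * h
      distrib = solve 2 (λ h r → h :+ r :* h := (con 1ℚ :+ r) :* h) refl
      h+r*h≡[1+r]*h : h + ℕ→ℚ r * h ≡ ℕ→ℚ (suc r) * h
      h+r*h≡[1+r]*h = trans (distrib h (ℕ→ℚ r)) (cong (_* h) (sym (ℕ→ℚ-+ 1 r)))

    ∏[1+ν/j]≈1+ν*H : ∀ a → ∏[1+w/j] p ν a ≈1+ν* H p a
    ∏[1+ν/j]≈1+ν*H a = ∣-weaken k≤m+m (∏[1+w/j]≡1+w*H p^m∣ν a)

    ∏[1-ν/j]≈1-ν*H : ∀ a → ∏[1+w/j] p (- ν) a ≈1+ν* (- H p a)
    ∏[1-ν/j]≈1-ν*H a = subst (λ z → p^ k ∣ (∏[1+w/j] p (- ν) a - (1ℚ + z))) (neg-swap ν (H p a))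
      (∣-weaken k≤m+m (∏[1+w/j]≡1+w*H (∣-neg p^m∣ν) a))
      where
      neg-swap : ∀ ν h → - ν * h ≡ ν * - h
      neg-swap = solve 2 (λ ν h → :- ν :* h := ν :* :- h) refl

module Congruence (p : ℕ) .{{_ : NonZero p}} (p-prime : Prime p) (p∤2 : ¬ p ∣ 2)
            (n q M : ℕ) (nq≡pM : n ℕ.* q ≡ p ℕ.* M) (1≤M : 1 ≤ M)
            {μ : ℕ} (1≤μ : 1 ≤ μ) (p^μ∣nq : p ℕ.^ μ ∣ n ℕ.* q) where

  open PAdic p p-prime
  open Factorisation p nq≡pM
  open NearOne {μ} {suc μ} (ℕ.+-monoˡ-≤ μ 1≤μ) (∣⇒p^∣ p^μ∣nq)

  [c]CN-factorises : ℕ → Set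
  [c]CN-factorises c = ∃[ R ] (ℕ→ℚ (c C (n ℕ.* q)) ≡ ℕ→ℚ ((c ℕ./ p) C M) * R) × R ≈1+ν* H p c

  [c]CN-factorises-below : ∀ {c} → c < n ℕ.* q → [c]CN-factorises c
  [c]CN-factorises-below {c} c<N = 1ℚ + ν * H p c , both-zero , mod-refl (1ℚ + ν * H p c)
    where
    c/p<M : c ℕ./ p < M
    c/p<M = m<n*o⇒m/o<n (subst (c <_) (trans nq≡pM (ℕ.*-comm p M)) c<N)
    both-zero : ℕ→ℚ (c C (n ℕ.* q)) ≡ ℕ→ℚ ((c ℕ./ p) C M) * (1ℚ + ν * H p c)
    both-zero = begin
      ℕ→ℚ (c C (n ℕ.* q))                          ≡⟨ cong ℕ→ℚ (k>n⇒nCk≡0 c<N) ⟩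
      0ℚ                                          ≡⟨ ℚ.*-zeroˡ (1ℚ + ν * H p c) ⟨
      0ℚ * (1ℚ + ν * H p c)                       ≡⟨ cong (λ z → ℕ→ℚ z * (1ℚ + ν * H p c)) (k>n⇒nCk≡0 c/p<M) ⟨
      ℕ→ℚ ((c ℕ./ p) C M) * (1ℚ + ν * H p c)      ∎

  [N+b]CN-factorises : ∀ b → [c]CN-factorises (n ℕ.* q ℕ.+ b)
  [N+b]CN-factorises b = ∏[1+w/j] p ν b , [N+b]CN-factorisation b ,
    mod-trans {x = ∏[1+w/j] p ν b} {y = 1ℚ + ν * H p b} {z = 1ℚ + ν * H p (n ℕ.* q ℕ.+ b)} (∏[1+ν/j]≈1+ν*H b) shift
    where
    p∣H[N+b]-H[b] : p^ 1 ∣ (H p (n ℕ.* q ℕ.+ b) - H p b)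
    p∣H[N+b]-H[b] = subst (λ z → p^ 1 ∣ (H p (z ℕ.+ b) - H p b)) (sym nq≡pM) (H-periodic-* p∤2 M b)
    negate : ∀ ν h h′ → - (ν * (h′ - h)) ≡ 1ℚ + ν * h - (1ℚ + ν * h′)
    negate = solve 3 (λ ν h h′ → :- (ν :* (h′ :- h)) := con 1ℚ :+ ν :* h :- (con 1ℚ :+ ν :* h′)) refl
    shift : p^ (suc μ) ∣ (1ℚ + ν * H p b - (1ℚ + ν * H p (n ℕ.* q ℕ.+ b)))
    shift = subst (p^ (suc μ) ∣_) (negate ν (H p b) (H p (n ℕ.* q ℕ.+ b)))
      (∣-neg (subst (p^_∣ (ν * (H p (n ℕ.* q ℕ.+ b) - H p b))) (ℕ.+-comm μ 1) (∣-* (∣⇒p^∣ p^μ∣nq) p∣H[N+b]-H[b])))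

  [c]CN-factorisation : ∀ c → [c]CN-factorises c
  [c]CN-factorisation c = [ [c]CN-factorises-below ,
                            (λ N≤c → subst [c]CN-factorises (ℕ.m+[n∸m]≡n N≤c) ([N+b]CN-factorises (c ℕ.∸ n ℕ.* q))) ]′
                          (ℕ.<-≤-connex c (n ℕ.* q))

  power-product≈1+ν*h : ∀ a b c r s t {R} → R ≈1+ν* H p c →
    ∏[1+w/j] p (- ν) a ^ᵠ r * ∏[1+w/j] p ν b ^ᵠ s * R ^ᵠ t ≈1+ν* (ℕ→ℚ r * - H p a + ℕ→ℚ s * H p b + ℕ→ℚ t * H p c)
  power-product≈1+ν*h a b c r s t {R} R≈1+ν*H =
    ≈1+ν*-* {P ^ᵠ r * Q ^ᵠ s} {R ^ᵠ t} (∣-+ r*Ha-integral s*Hb-integral) (∣-* (∣-ℕ t) (H-integral c))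
      (≈1+ν*-* {P ^ᵠ r} {Q ^ᵠ s} r*Ha-integral s*Hb-integral
        (≈1+ν*-^ {P} (∣-neg (H-integral a)) (∏[1-ν/j]≈1-ν*H a) r)
        (≈1+ν*-^ {Q} (H-integral b) (∏[1+ν/j]≈1+ν*H b) s))
      (≈1+ν*-^ {R} (H-integral c) R≈1+ν*H t)
    where
    P = ∏[1+w/j] p (- ν) a
    Q = ∏[1+w/j] p ν b
    r*Ha-integral : Integral (ℕ→ℚ r * - H p a)
    r*Ha-integral = ∣-* (∣-ℕ r) (∣-neg (H-integral a))
    s*Hb-integral : Integral (ℕ→ℚ s * H p b)
    s*Hb-integral = ∣-* (∣-ℕ s) (H-integral b)

  1+ν*h≡1-rN*Ha+sN*Hb+tN*Hc : ∀ a b c r s t →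
    1ℚ + ν * (ℕ→ℚ r * - H p a + ℕ→ℚ s * H p b + ℕ→ℚ t * H p c)
      ≡ 1ℚ - ℕ→ℚ (r ℕ.* n ℕ.* q) * H p a + ℕ→ℚ (s ℕ.* n ℕ.* q) * H p b + ℕ→ℚ (t ℕ.* n ℕ.* q) * H p c
  1+ν*h≡1-rN*Ha+sN*Hb+tN*Hc a b c r s t = begin
    1ℚ + ν * (ℕ→ℚ r * - H p a + ℕ→ℚ s * H p b + ℕ→ℚ t * H p c)
      ≡⟨ expand ν (ℕ→ℚ r) (ℕ→ℚ s) (ℕ→ℚ t) (H p a) (H p b) (H p c) ⟩
    1ℚ - ℕ→ℚ r * ν * H p a + ℕ→ℚ s * ν * H p b + ℕ→ℚ t * ν * H p c
      ≡⟨ cong₂ (λ x y → 1ℚ - x * H p a + y * H p b + ℕ→ℚ t * ν * H p c) (ℕ→ℚ[k*n*q]≡k*ν r) (ℕ→ℚ[k*n*q]≡k*ν s) ⟨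
    1ℚ - ℕ→ℚ (r ℕ.* n ℕ.* q) * H p a + ℕ→ℚ (s ℕ.* n ℕ.* q) * H p b + ℕ→ℚ t * ν * H p c
      ≡⟨ cong (λ z → 1ℚ - ℕ→ℚ (r ℕ.* n ℕ.* q) * H p a + ℕ→ℚ (s ℕ.* n ℕ.* q) * H p b + z * H p c)
              (ℕ→ℚ[k*n*q]≡k*ν t) ⟨
    1ℚ - ℕ→ℚ (r ℕ.* n ℕ.* q) * H p a + ℕ→ℚ (s ℕ.* n ℕ.* q) * H p b + ℕ→ℚ (t ℕ.* n ℕ.* q) * H p c
      ∎
    where
    ℕ→ℚ[k*n*q]≡k*ν : ∀ k → ℕ→ℚ (k ℕ.* n ℕ.* q) ≡ ℕ→ℚ k * ν
    ℕ→ℚ[k*n*q]≡k*ν k = trans (cong ℕ→ℚ (ℕ.*-assoc k n q)) (ℕ→ℚ-* k (n ℕ.* q))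
    expand : ∀ ν r s t x y z → 1ℚ + ν * (r * - x + s * y + t * z) ≡ 1ℚ - r * ν * x + s * ν * y + t * ν * z
    expand = solve 7 (λ ν r s t x y z →
      con 1ℚ :+ ν :* (r :* :- x :+ s :* y :+ t :* z)
      := con 1ℚ :- r :* ν :* x :+ s :* ν :* y :+ t :* ν :* z) refl

  binomial-congruence : ∀ a b c r s t →
    p^ (suc μ) ∣
      (ℕ→ℚ ((n ℕ.* q ℕ.∸ 1) C a) ^ᵠ r * ℕ→ℚ ((n ℕ.* q ℕ.+ b) C b) ^ᵠ s * ℕ→ℚ (c C (n ℕ.* q)) ^ᵠ t
       - (- 1ℚ) ^ᵠ (r ℕ.* (a ℕ.+ a ℕ./ p)) * ℕ→ℚ ((M ℕ.∸ 1) C (a ℕ./ p)) ^ᵠ r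
         * ℕ→ℚ ((M ℕ.+ b ℕ./ p) C (b ℕ./ p)) ^ᵠ s * ℕ→ℚ ((c ℕ./ p) C M) ^ᵠ t
         * (1ℚ - ℕ→ℚ (r ℕ.* n ℕ.* q) * H p a + ℕ→ℚ (s ℕ.* n ℕ.* q) * H p b + ℕ→ℚ (t ℕ.* n ℕ.* q) * H p c))
  binomial-congruence a b c r s t =
    subst (p^ (suc μ) ∣_) (cong₂ _-_ X*Π≡LHS X*[1+ν*h]≡RHS)
      (mod-*ˡ X X-integral (power-product≈1+ν*h a b c r s t R≈1+ν*H))
    where
    R = proj₁ ([c]CN-factorisation c)
    c-factorisation = proj₁ (proj₂ ([c]CN-factorisation c))
    R≈1+ν*H = proj₂ (proj₂ ([c]CN-factorisation c))
    σ = (- 1ℚ) ^ᵠ (a ℕ.+ a ℕ./ p)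
    A = ℕ→ℚ ((M ℕ.∸ 1) C (a ℕ./ p))
    B = ℕ→ℚ ((M ℕ.+ b ℕ./ p) C (b ℕ./ p))
    C′ = ℕ→ℚ ((c ℕ./ p) C M)
    P = ∏[1+w/j] p (- ν) a
    Q = ∏[1+w/j] p ν b
    X = σ ^ᵠ r * A ^ᵠ r * B ^ᵠ s * C′ ^ᵠ t

    X-integral : Integral X
    X-integral = ∣-* (∣-* (∣-* (∣-^ᵠ (∣-^ᵠ (∣-neg (∣-ℕ 1)) (a ℕ.+ a ℕ./ p)) r)
                                (∣-^ᵠ (∣-ℕ ((M ℕ.∸ 1) C (a ℕ./ p))) r))
                          (∣-^ᵠ (∣-ℕ ((M ℕ.+ b ℕ./ p) C (b ℕ./ p))) s))
                    (∣-^ᵠ (∣-ℕ ((c ℕ./ p) C M)) t)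

    regroup : ∀ σ A B C P Q R → σ * A * B * C * (P * Q * R) ≡ σ * A * P * (B * Q) * (C * R)
    regroup = solve 7 (λ σ A B C P Q R →
      σ :* A :* B :* C :* (P :* Q :* R)
      := σ :* A :* P :* (B :* Q) :* (C :* R)) refl
    X*Π≡LHS : X * (P ^ᵠ r * Q ^ᵠ s * R ^ᵠ t)
              ≡ ℕ→ℚ ((n ℕ.* q ℕ.∸ 1) C a) ^ᵠ r * ℕ→ℚ ((n ℕ.* q ℕ.+ b) C b) ^ᵠ s * ℕ→ℚ (c C (n ℕ.* q)) ^ᵠ t
    X*Π≡LHS = begin
      X * (P ^ᵠ r * Q ^ᵠ s * R ^ᵠ t)
        ≡⟨ regroup (σ ^ᵠ r) (A ^ᵠ r) (B ^ᵠ s) (C′ ^ᵠ t) (P ^ᵠ r) (Q ^ᵠ s) (R ^ᵠ t) ⟩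
      σ ^ᵠ r * A ^ᵠ r * P ^ᵠ r * (B ^ᵠ s * Q ^ᵠ s) * (C′ ^ᵠ t * R ^ᵠ t)
        ≡⟨ cong₂ _*_ (cong₂ _*_ (trans (^ᵠ-distribʳ-* (σ * A) P r) (cong (_* P ^ᵠ r) (^ᵠ-distribʳ-* σ A r)))
                                (^ᵠ-distribʳ-* B Q s))
                     (^ᵠ-distribʳ-* C′ R t) ⟨
      (σ * A * P) ^ᵠ r * (B * Q) ^ᵠ s * (C′ * R) ^ᵠ t
        ≡⟨ cong₂ _*_ (cong₂ _*_ (cong (_^ᵠ r) ([N∸1]C-factorisation 1≤M a))
                                (cong (_^ᵠ s) ([N+b]Cb-factorisation b)))
                     (cong (_^ᵠ t) c-factorisation) ⟨
      ℕ→ℚ ((n ℕ.* q ℕ.∸ 1) C a) ^ᵠ r * ℕ→ℚ ((n ℕ.* q ℕ.+ b) C b) ^ᵠ s * ℕ→ℚ (c C (n ℕ.* q)) ^ᵠ t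
        ∎

    X*[1+ν*h]≡RHS : X * (1ℚ + ν * (ℕ→ℚ r * - H p a + ℕ→ℚ s * H p b + ℕ→ℚ t * H p c))
      ≡ (- 1ℚ) ^ᵠ (r ℕ.* (a ℕ.+ a ℕ./ p)) * A ^ᵠ r * B ^ᵠ s * C′ ^ᵠ t
        * (1ℚ - ℕ→ℚ (r ℕ.* n ℕ.* q) * H p a + ℕ→ℚ (s ℕ.* n ℕ.* q) * H p b + ℕ→ℚ (t ℕ.* n ℕ.* q) * H p c)
    X*[1+ν*h]≡RHS =
      cong₂ _*_ (cong (λ z → z * A ^ᵠ r * B ^ᵠ s * C′ ^ᵠ t) (sym (x^[m*n]≡[x^n]^m (- 1ℚ) r (a ℕ.+ a ℕ./ p))))
                (1+ν*h≡1-rN*Ha+sN*Hb+tN*Hc a b c r s t)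

lemma2p2 : (p : ℕ) .{{_ : NonZero p}} → Prime p → 5 ≤ p →
           (a b c r s t n m : ℕ) → 1 ≤ n → 1 ≤ m →
           ModEq p (ℕ.suc m)
             (((ℕ→ℚ ((n ℕ.* p ℕ.^ m ℕ.∸ 1) C a)) ^ᵠ r)
               * ((ℕ→ℚ ((n ℕ.* p ℕ.^ m ℕ.+ b) C b)) ^ᵠ s)
               * ((ℕ→ℚ (c C (n ℕ.* p ℕ.^ m))) ^ᵠ t))
             (((- 1ℚ) ^ᵠ (r ℕ.* (a ℕ.+ a ℕ./ p)))
               * ((ℕ→ℚ ((n ℕ.* p ℕ.^ (m ℕ.∸ 1) ℕ.∸ 1) C (a ℕ./ p))) ^ᵠ r)
               * ((ℕ→ℚ ((n ℕ.* p ℕ.^ (m ℕ.∸ 1) ℕ.+ b ℕ./ p) C (b ℕ./ p))) ^ᵠ s)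
               * ((ℕ→ℚ ((c ℕ./ p) C (n ℕ.* p ℕ.^ (m ℕ.∸ 1)))) ^ᵠ t)
               * (1ℚ - ℕ→ℚ (r ℕ.* n ℕ.* p ℕ.^ m) * H p a
                    + ℕ→ℚ (s ℕ.* n ℕ.* p ℕ.^ m) * H p b
                    + ℕ→ℚ (t ℕ.* n ℕ.* p ℕ.^ m) * H p c))
lemma2p2 p p-prime 5≤p a b c r s t n m 1≤n 1≤m =
  PAdic.p^k∣z⇒∃ p p-prime
    (Congruence.binomial-congruence p p-prime p∤2 n (p ℕ.^ m) (n ℕ.* p ℕ.^ (m ℕ.∸ 1)) (n*p^m≡p*[n*p^[m∸1]] 1≤m)
       (ℕ.*-mono-≤ 1≤n (ℕ.m^n>0 p (m ℕ.∸ 1))) 1≤m (n∣m*n n) a b c r s t)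
  where
  p∤2 : ¬ p ∣ 2
  p∤2 = >⇒∤ (ℕ.≤-trans (s≤s (s≤s (s≤s z≤n))) 5≤p)
  swap : ∀ n p x → n ℕ.* (p ℕ.* x) ≡ p ℕ.* (n ℕ.* x)
  swap = ℕ-Solver.solve-∀
  n*p^m≡p*[n*p^[m∸1]] : ∀ {m} → 1 ≤ m → n ℕ.* p ℕ.^ m ≡ p ℕ.* (n ℕ.* p ℕ.^ (m ℕ.∸ 1))
  n*p^m≡p*[n*p^[m∸1]] {suc m} _ = swap n p (p ℕ.^ m)
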